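{- Let $\Gamma$ be a typing context, $x\notin\mathrm{dom}(\Gamma)$ a variable, $M$ a computation, $V$ a value, $\tau$ a configuration type. (1) If $\Gamma,x:\delta\vdash M:\tau$ and $\Gamma\vdash V:\delta$, then $\Gamma\vdash M[V/x]:\tau$. (2) If $\Gamma\vdash M[V/x]:\tau$, then there exists a value type $\delta$ such that $\Gamma\vdash V:\delta$ and $\Gamma,x:\delta\vdash M:\tau$.
   Context: Syntax. Fix a countably infinite set $\mathbf{L}$ of locations. Values $V,W ::= x \mid \lambda x.M$; computations $M,N ::= [V] \mid M \star V \mid \mathit{get}_\ell(\lambda x.M) \mid \mathit{set}_\ell(V,M)$ ($\ell\in\mathbf{L}$); $x$ bound in $\lambda x.M$ and $\mathit{get}_\ell(\lambda x.M)$; terms up to renaming of bound variables; $M[V/x]$ capture-avoiding substitution. Store terms $s ::= \mathrm{emp} \mid \mathrm{upd}_\ell(u,s)$, lookup terms $u ::= V\mid\mathrm{lkp}_\ell(s)$; $\mathrm{dom}(\mathrm{emp})=\emptyset$, $\mathrm{dom}(\mathrm{upd}_\ell(u,s))=\{\ell\}\cup\mathrm{dom}(s)$. Types. Value types $\delta ::= \delta\to\tau \mid \delta\wedge\delta \mid \omega_D$; store types $\sigma ::= \langle \ell:\delta\rangle \mid \sigma\wedge\sigma \mid \omega_S$; computation types $\kappa ::= \delta\times\sigma \mid \kappa\wedge\kappa\mid\omega_C$; configuration types $\tau ::= \sigma\to\kappa \mid \tau\wedge\tau \mid \omega_T$. For each sort $A$, $\le_A$ is the least preorder with $\varphi\le\omega_A$,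 $\varphi\wedge\psi\le\varphi$, $\varphi\wedge\psi\le\psi$, $\varphi\le\varphi\wedge\varphi$, monotonicity of $\wedge$, and: $\omega_D\le\omega_D\to\omega_T$; $(\delta\to\tau)\wedge(\delta\to\tau')\le\delta\to(\tau\wedge\tau')$; $\langle\ell:\delta\rangle\wedge\langle\ell:\delta'\rangle\le\langle\ell:\delta\wedge\delta'\rangle$; $\omega_C\le\omega_D\times\omega_S$; $(\delta\times\sigma)\wedge(\delta'\times\sigma')\le(\delta\wedge\delta')\times(\sigma\wedge\sigma')$; $\omega_T\le\omega_S\to\omega_C$; $(\sigma\to\kappa)\wedge(\sigma\to\kappa')\le\sigma\to(\kappa\wedge\kappa')$; arrows contravariant in argument and covariant in result; $\times$ and $\langle\ell:\cdot\rangle$ covariant. $\mathrm{dom}(\langle\ell:\delta\rangle)=\{\ell\}$, $\mathrm{dom}(\sigma\wedge\sigma')=\mathrm{dom}(\sigma)\cup\mathrm{dom}(\sigma')$, $\mathrm{dom}(\omega_S)=\emptyset$. Type system. Contexts $\Gamma$ are finite maps from variables to value types; $\Gamma,x:\delta$ requires $x\notin\mathrm{dom}(\Gamma)$. Rules: $\Gamma\vdash Q:\omega_A$ for $Q$ of the corresponding sort; intersection introduction; subsumption along $\le$; $\Gamma,x:\delta\vdash x:\delta$; $\Gamma,x:\delta\vdash M:\tau\Rightarrow\Gamma\vdash\lambda x.M:\delta\to\tau$; $\Gamma\vdash V:\delta\Rightarrow\Gamma\vdash[V]:\sigma\to\delta\times\sigma$; $\Gamma\vdash M:\sigma\to\delta'\times\sigma'$,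 $\Gamma\vdash V:\delta'\to\sigma'\to\delta''\times\sigma''\Rightarrow\Gamma\vdash M\star V:\sigma\to\delta''\times\sigma''$; $\Gamma,x:\delta\vdash M:\sigma\to\kappa\Rightarrow\Gamma\vdash\mathit{get}_\ell(\lambda x.M):(\langle\ell:\delta\rangle\wedge\sigma)\to\kappa$; $\Gamma\vdash V:\delta$, $\Gamma\vdash M:(\langle\ell:\delta\rangle\wedge\sigma)\to\kappa$, $\ell\notin\mathrm{dom}(\sigma)\Rightarrow\Gamma\vdash\mathit{set}_\ell(V,M):\sigma\to\kappa$; $\Gamma\vdash V:\delta\Rightarrow\Gamma\vdash\mathrm{upd}_\ell(V,s):\langle\ell:\delta\rangle$; $\Gamma\vdash s:\langle\ell':\delta\rangle$, $\ell\ne\ell'\Rightarrow\Gamma\vdash\mathrm{upd}_\ell(V,s):\langle\ell':\delta\rangle$; $\Gamma\vdash s:\langle\ell:\delta\rangle\Rightarrow\Gamma\vdash\mathrm{lkp}_\ell(s):\delta$. -}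

module Defs where

open import Data.Nat using (ℕ; zero; suc)
open import Data.List using (List; []; _∷_)
open import Data.Empty using (⊥)
open import Data.Sum using (_⊎_)
open import Relation.Binary.PropositionalEquality using (_≡_)
open import Relation.Nullary using (¬_)

Loc : Set
Loc = ℕ

-- Syntax (terms up to α-renaming, represented with de Bruijn indices).
-- Variables are natural numbers; free variables are arbitrary indices
-- (terms are not scope-restricted).  Binders: λ and get.

infixl 5 _⋆_

mutual
  data Val : Set where
    var : ℕ → Val
    lam : Comp → Val

  data Comp : Set where
    ret  : Val → Comp
    _⋆_  : Comp → Val → Comp
    get  : Loc → Comp → Comp         -- get_ℓ(λx.M)  (x = index 0 in M)
    set  : Loc → Val → Comp → Comp

Ren : Set
Ren = ℕ → ℕ

ext : Ren → Ren
ext ρ zero    = zero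
ext ρ (suc n) = suc (ρ n)

mutual
  renV : Ren → Val → Val
  renV ρ (var n) = var (ρ n)
  renV ρ (lam M) = lam (renC (ext ρ) M)

  renC : Ren → Comp → Comp
  renC ρ (ret V)     = ret (renV ρ V)
  renC ρ (M ⋆ V)     = renC ρ M ⋆ renV ρ V
  renC ρ (get ℓ M)   = get ℓ (renC (ext ρ) M)
  renC ρ (set ℓ V M) = set ℓ (renV ρ V) (renC ρ M)

Sub : Set
Sub = ℕ → Val

exts : Sub → Sub
exts s zero    = var zero
exts s (suc n) = renV suc (s n)

mutual
  subV : Sub → Val → Val
  subV s (var n) = s n
  subV s (lam M) = lam (subC (exts s) M)

  subC : Sub → Comp → Comp
  subC s (ret V)     = ret (subV s V)
  subC s (M ⋆ V)     = subC s M ⋆ subV s V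
  subC s (get ℓ M)   = get ℓ (subC (exts s) M)
  subC s (set ℓ V M) = set ℓ (subV s V) (subC s M)

-- single substitution for the outermost variable (index 0):
-- M [ V ] is M[V/x] where x is index 0 of M; other free variables
-- of M are shifted down by one.
single : Val → Sub
single V zero    = V
single V (suc n) = var n

_[_] : Comp → Val → Comp
M [ V ] = subC (single V) M

infixr 7 _⇒_ _↦_
infixl 8 _⊗_
infixl 9 _∧D_ _∧S_ _∧C_ _∧T_

mutual
  data VType : Set where
    _⇒_ : VType → TType → VType
    _∧D_ : VType → VType → VType
    ωD  : VType

  data SType : Set where
    ⟨_∶_⟩ : Loc → VType → SType
    _∧S_ : SType → SType → SType
    ωS   : SType

  data CType : Set where
    _⊗_ : VType → SType → CType
    _∧C_ : CType → CType → CType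
    ωC  : CType

  data TType : Set where
    _↦_ : SType → CType → TType
    _∧T_ : TType → TType → TType
    ωT  : TType

_∈dom_ : Loc → SType → Set
ℓ ∈dom ⟨ ℓ' ∶ δ ⟩ = ℓ ≡ ℓ'
ℓ ∈dom (σ ∧S σ') = ℓ ∈dom σ ⊎ ℓ ∈dom σ'
ℓ ∈dom ωS        = ⊥

infix 4 _≤D_ _≤S_ _≤C_ _≤T_

mutual
  data _≤D_ : VType → VType → Set where
    reflD   : ∀ {δ} → δ ≤D δ
    transD  : ∀ {δ₁ δ₂ δ₃} → δ₁ ≤D δ₂ → δ₂ ≤D δ₃ → δ₁ ≤D δ₃
    topD    : ∀ {δ} → δ ≤D ωD
    lbˡD    : ∀ {δ δ'} → δ ∧D δ' ≤D δ
    lbʳD    : ∀ {δ δ'} → δ ∧D δ' ≤D δ'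
    dupD    : ∀ {δ} → δ ≤D δ ∧D δ
    monoD   : ∀ {δ₁ δ₂ δ₁' δ₂'} → δ₁ ≤D δ₁' → δ₂ ≤D δ₂' → δ₁ ∧D δ₂ ≤D δ₁' ∧D δ₂'
    ω⇒      : ωD ≤D ωD ⇒ ωT
    ∧⇒      : ∀ {δ τ τ'} → (δ ⇒ τ) ∧D (δ ⇒ τ') ≤D δ ⇒ (τ ∧T τ')
    ⇒-mono  : ∀ {δ δ' τ τ'} → δ' ≤D δ → τ ≤T τ' → δ ⇒ τ ≤D δ' ⇒ τ'

  data _≤S_ : SType → SType → Set where
    reflS   : ∀ {σ} → σ ≤S σ
    transS  : ∀ {σ₁ σ₂ σ₃} → σ₁ ≤S σ₂ → σ₂ ≤S σ₃ → σ₁ ≤S σ₃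
    topS    : ∀ {σ} → σ ≤S ωS
    lbˡS    : ∀ {σ σ'} → σ ∧S σ' ≤S σ
    lbʳS    : ∀ {σ σ'} → σ ∧S σ' ≤S σ'
    dupS    : ∀ {σ} → σ ≤S σ ∧S σ
    monoS   : ∀ {σ₁ σ₂ σ₁' σ₂'} → σ₁ ≤S σ₁' → σ₂ ≤S σ₂' → σ₁ ∧S σ₂ ≤S σ₁' ∧S σ₂'
    ∧loc    : ∀ {ℓ δ δ'} → ⟨ ℓ ∶ δ ⟩ ∧S ⟨ ℓ ∶ δ' ⟩ ≤S ⟨ ℓ ∶ δ ∧D δ' ⟩
    loc-mono : ∀ {ℓ δ δ'} → δ ≤D δ' → ⟨ ℓ ∶ δ ⟩ ≤S ⟨ ℓ ∶ δ' ⟩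

  data _≤C_ : CType → CType → Set where
    reflC   : ∀ {κ} → κ ≤C κ
    transC  : ∀ {κ₁ κ₂ κ₃} → κ₁ ≤C κ₂ → κ₂ ≤C κ₃ → κ₁ ≤C κ₃
    topC    : ∀ {κ} → κ ≤C ωC
    lbˡC    : ∀ {κ κ'} → κ ∧C κ' ≤C κ
    lbʳC    : ∀ {κ κ'} → κ ∧C κ' ≤C κ'
    dupC    : ∀ {κ} → κ ≤C κ ∧C κ
    monoC   : ∀ {κ₁ κ₂ κ₁' κ₂'} → κ₁ ≤C κ₁' → κ₂ ≤C κ₂' → κ₁ ∧C κ₂ ≤C κ₁' ∧C κ₂'
    ω⊗      : ωC ≤C ωD ⊗ ωS
    ∧⊗      : ∀ {δ δ' σ σ'} → (δ ⊗ σ) ∧C (δ' ⊗ σ') ≤C (δ ∧D δ') ⊗ (σ ∧S σ')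
    ⊗-mono  : ∀ {δ δ' σ σ'} → δ ≤D δ' → σ ≤S σ' → δ ⊗ σ ≤C δ' ⊗ σ'

  data _≤T_ : TType → TType → Set where
    reflT   : ∀ {τ} → τ ≤T τ
    transT  : ∀ {τ₁ τ₂ τ₃} → τ₁ ≤T τ₂ → τ₂ ≤T τ₃ → τ₁ ≤T τ₃
    topT    : ∀ {τ} → τ ≤T ωT
    lbˡT    : ∀ {τ τ'} → τ ∧T τ' ≤T τ
    lbʳT    : ∀ {τ τ'} → τ ∧T τ' ≤T τ'
    dupT    : ∀ {τ} → τ ≤T τ ∧T τ
    monoT   : ∀ {τ₁ τ₂ τ₁' τ₂'} → τ₁ ≤T τ₁' → τ₂ ≤T τ₂' → τ₁ ∧T τ₂ ≤T τ₁' ∧T τ₂'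
    ω↦      : ωT ≤T ωS ↦ ωC
    ∧↦      : ∀ {σ κ κ'} → (σ ↦ κ) ∧T (σ ↦ κ') ≤T σ ↦ (κ ∧C κ')
    ↦-mono  : ∀ {σ σ' κ κ'} → σ' ≤S σ → κ ≤C κ' → σ ↦ κ ≤T σ' ↦ κ'

-- Contexts: the context δ ∷ Γ is "Γ, x:δ" with x the de Bruijn index 0
-- (the variables of Γ being shifted by one).  Variables with index
-- ≥ length Γ are not in dom(Γ).

Ctx : Set
Ctx = List VType

infix 4 _∋_∶_
data _∋_∶_ : Ctx → ℕ → VType → Set where
  here  : ∀ {Γ δ} → (δ ∷ Γ) ∋ zero ∶ δ
  there : ∀ {Γ n δ δ'} → Γ ∋ n ∶ δ → (δ' ∷ Γ) ∋ suc n ∶ δ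

-- Typing (values and computations; store/lookup terms are not needed
-- for the statement).

infix 4 _⊢v_∶_ _⊢c_∶_

mutual
  data _⊢v_∶_ (Γ : Ctx) : Val → VType → Set where
    ωv   : ∀ {V} → Γ ⊢v V ∶ ωD
    ∧v   : ∀ {V δ δ'} → Γ ⊢v V ∶ δ → Γ ⊢v V ∶ δ' → Γ ⊢v V ∶ δ ∧D δ'
    subv : ∀ {V δ δ'} → Γ ⊢v V ∶ δ → δ ≤D δ' → Γ ⊢v V ∶ δ'
    varv : ∀ {n δ} → Γ ∋ n ∶ δ → Γ ⊢v var n ∶ δ
    lamv : ∀ {M δ τ} → (δ ∷ Γ) ⊢c M ∶ τ → Γ ⊢v lam M ∶ δ ⇒ τ

  data _⊢c_∶_ (Γ : Ctx) : Comp → TType → Set where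
    ωc   : ∀ {M} → Γ ⊢c M ∶ ωT
    ∧c   : ∀ {M τ τ'} → Γ ⊢c M ∶ τ → Γ ⊢c M ∶ τ' → Γ ⊢c M ∶ τ ∧T τ'
    subc : ∀ {M τ τ'} → Γ ⊢c M ∶ τ → τ ≤T τ' → Γ ⊢c M ∶ τ'
    retc : ∀ {V δ σ} → Γ ⊢v V ∶ δ → Γ ⊢c ret V ∶ σ ↦ δ ⊗ σ
    bindc : ∀ {M V σ δ' σ' δ'' σ''} →
            Γ ⊢c M ∶ σ ↦ δ' ⊗ σ' →
            Γ ⊢v V ∶ δ' ⇒ (σ' ↦ δ'' ⊗ σ'') →
            Γ ⊢c M ⋆ V ∶ σ ↦ δ'' ⊗ σ''
    getc : ∀ {ℓ M δ σ κ} → (δ ∷ Γ) ⊢c M ∶ σ ↦ κ →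
           Γ ⊢c get ℓ M ∶ (⟨ ℓ ∶ δ ⟩ ∧S σ) ↦ κ
    setc : ∀ {ℓ V M δ σ κ} → Γ ⊢v V ∶ δ →
           Γ ⊢c M ∶ (⟨ ℓ ∶ δ ⟩ ∧S σ) ↦ κ → ¬ (ℓ ∈dom σ) →
           Γ ⊢c set ℓ V M ∶ σ ↦ κ

{-# OPTIONS --safe #-}
module Submission where

open import Defs
open import Data.Nat using (ℕ; zero; suc)
open import Data.List using ([]; _∷_; _++_; length)
open import Data.Product using (_×_; ∃; _,_; map₂)
open import Relation.Binary.PropositionalEquality using (_≡_; refl; cong; cong₂; subst)

-- For part (2) one inverts a
-- derivation for M[V/x] by induction on M, under a growing prefix Δ of
-- binders: every use of V inside the derivation yields a type of V, and the
-- type assigned to x is the intersection of all of them (ω if V is never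
-- used).  Combining the types found for the premises of a rule requires
-- narrowing the type of x, which is where the intersection rules come in.

RenTyping : Ctx → Ren → Ctx → Set
RenTyping Γ′ ρ Γ = ∀ {n δ} → Γ ∋ n ∶ δ → ∃ λ δ′ → Γ′ ∋ ρ n ∶ δ′ × δ′ ≤D δ

ext-RenTyping : ∀ {Γ Γ′ ρ δ} → RenTyping Γ′ ρ Γ → RenTyping (δ ∷ Γ′) (ext ρ) (δ ∷ Γ)
ext-RenTyping ρ-ok here      = _ , here , reflD
ext-RenTyping ρ-ok (there x) = map₂ (λ (y , le) → there y , le) (ρ-ok x)

mutual
  rename-⊢v : ∀ {Γ Γ′ ρ W δ} → RenTyping Γ′ ρ Γ → Γ ⊢v W ∶ δ → Γ′ ⊢v renV ρ W ∶ δ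
  rename-⊢v ρ-ok ωv          = ωv
  rename-⊢v ρ-ok (∧v d e)    = ∧v (rename-⊢v ρ-ok d) (rename-⊢v ρ-ok e)
  rename-⊢v ρ-ok (subv d le) = subv (rename-⊢v ρ-ok d) le
  rename-⊢v ρ-ok (varv x)    with ρ-ok x
  ... | _ , y , le = subv (varv y) le
  rename-⊢v ρ-ok (lamv d)    = lamv (rename-⊢c (ext-RenTyping ρ-ok) d)

  rename-⊢c : ∀ {Γ Γ′ ρ M τ} → RenTyping Γ′ ρ Γ → Γ ⊢c M ∶ τ → Γ′ ⊢c renC ρ M ∶ τ
  rename-⊢c ρ-ok ωc            = ωc
  rename-⊢c ρ-ok (∧c d e)      = ∧c (rename-⊢c ρ-ok d) (rename-⊢c ρ-ok e)
  rename-⊢c ρ-ok (subc d le)   = subc (rename-⊢c ρ-ok d) le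
  rename-⊢c ρ-ok (retc d)      = retc (rename-⊢v ρ-ok d)
  rename-⊢c ρ-ok (bindc d e)   = bindc (rename-⊢c ρ-ok d) (rename-⊢v ρ-ok e)
  rename-⊢c ρ-ok (getc d)      = getc (rename-⊢c (ext-RenTyping ρ-ok) d)
  rename-⊢c ρ-ok (setc d e ℓ∉) = setc (rename-⊢v ρ-ok d) (rename-⊢c ρ-ok e) ℓ∉

weaken-⊢v : ∀ {Γ W δ δ₁} → Γ ⊢v W ∶ δ → (δ₁ ∷ Γ) ⊢v renV suc W ∶ δ
weaken-⊢v = rename-⊢v (λ x → _ , there x , reflD)

ext-id : ∀ {ρ} → (∀ n → ρ n ≡ n) → ∀ n → ext ρ n ≡ n
ext-id ρ≗id zero    = refl
ext-id ρ≗id (suc n) = cong suc (ρ≗id n)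

mutual
  renV-id : ∀ {ρ} → (∀ n → ρ n ≡ n) → ∀ W → renV ρ W ≡ W
  renV-id ρ≗id (var n) = cong var (ρ≗id n)
  renV-id ρ≗id (lam M) = cong lam (renC-id (ext-id ρ≗id) M)

  renC-id : ∀ {ρ} → (∀ n → ρ n ≡ n) → ∀ M → renC ρ M ≡ M
  renC-id ρ≗id (ret V)     = cong ret (renV-id ρ≗id V)
  renC-id ρ≗id (M ⋆ V)     = cong₂ _⋆_ (renC-id ρ≗id M) (renV-id ρ≗id V)
  renC-id ρ≗id (get ℓ M)   = cong (get ℓ) (renC-id (ext-id ρ≗id) M)
  renC-id ρ≗id (set ℓ V M) = cong₂ (set ℓ) (renV-id ρ≗id V) (renC-id ρ≗id M)

narrowing-RenTyping : ∀ Δ {Γ δ δ′} → δ′ ≤D δ →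
                      RenTyping (Δ ++ δ′ ∷ Γ) (λ n → n) (Δ ++ δ ∷ Γ)
narrowing-RenTyping []      le here      = _ , here , le
narrowing-RenTyping []      le (there x) = _ , there x , reflD
narrowing-RenTyping (_ ∷ Δ) le here      = _ , here , reflD
narrowing-RenTyping (_ ∷ Δ) le (there x) =
  map₂ (λ (y , le′) → there y , le′) (narrowing-RenTyping Δ le x)

narrow-⊢v : ∀ Δ {Γ δ δ′ W δ₀} → δ′ ≤D δ → (Δ ++ δ ∷ Γ) ⊢v W ∶ δ₀ → (Δ ++ δ′ ∷ Γ) ⊢v W ∶ δ₀
narrow-⊢v Δ {W = W} le d =
  subst (λ W′ → _ ⊢v W′ ∶ _) (renV-id (λ _ → refl) W) (rename-⊢v (narrowing-RenTyping Δ le) d)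

narrow-⊢c : ∀ Δ {Γ δ δ′ M τ} → δ′ ≤D δ → (Δ ++ δ ∷ Γ) ⊢c M ∶ τ → (Δ ++ δ′ ∷ Γ) ⊢c M ∶ τ
narrow-⊢c Δ {M = M} le d =
  subst (λ M′ → _ ⊢c M′ ∶ _) (renC-id (λ _ → refl) M) (rename-⊢c (narrowing-RenTyping Δ le) d)

RenReflects : Ctx → Ren → Ctx → Set
RenReflects Γ′ ρ Γ = ∀ {n δ} → Γ′ ∋ ρ n ∶ δ → Γ ∋ n ∶ δ

ext-RenReflects : ∀ {Γ Γ′ ρ δ} → RenReflects Γ′ ρ Γ → RenReflects (δ ∷ Γ′) (ext ρ) (δ ∷ Γ)
ext-RenReflects ρ-refl {zero}  here      = here
ext-RenReflects ρ-refl {suc n} (there x) = there (ρ-refl x)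

-- The derivation is analysed first and the equation fixes the shape of the
-- term only in the syntax-directed cases, since renV ρ W does not reduce
-- before W is known; the inversion lemmas below use the same device.
mutual
  strengthen-⊢v : ∀ {Γ Γ′ ρ W′ δ} W → RenReflects Γ′ ρ Γ → renV ρ W ≡ W′ →
                  Γ′ ⊢v W′ ∶ δ → Γ ⊢v W ∶ δ
  strengthen-⊢v W       ρ-refl eq   ωv          = ωv
  strengthen-⊢v W       ρ-refl eq   (∧v d e)    =
    ∧v (strengthen-⊢v W ρ-refl eq d) (strengthen-⊢v W ρ-refl eq e)
  strengthen-⊢v W       ρ-refl eq   (subv d le) = subv (strengthen-⊢v W ρ-refl eq d) le
  strengthen-⊢v (var n) ρ-refl refl (varv x)    = varv (ρ-refl x)
  strengthen-⊢v (lam M) ρ-refl refl (lamv d)    =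
    lamv (strengthen-⊢c M (ext-RenReflects ρ-refl) refl d)

  strengthen-⊢c : ∀ {Γ Γ′ ρ M′ τ} M → RenReflects Γ′ ρ Γ → renC ρ M ≡ M′ →
                  Γ′ ⊢c M′ ∶ τ → Γ ⊢c M ∶ τ
  strengthen-⊢c M           ρ-refl eq   ωc            = ωc
  strengthen-⊢c M           ρ-refl eq   (∧c d e)      =
    ∧c (strengthen-⊢c M ρ-refl eq d) (strengthen-⊢c M ρ-refl eq e)
  strengthen-⊢c M           ρ-refl eq   (subc d le)   = subc (strengthen-⊢c M ρ-refl eq d) le
  strengthen-⊢c (ret W)     ρ-refl refl (retc d)      = retc (strengthen-⊢v W ρ-refl refl d)
  strengthen-⊢c (M ⋆ W)     ρ-refl refl (bindc d e)   =
    bindc (strengthen-⊢c M ρ-refl refl d) (strengthen-⊢v W ρ-refl refl e)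
  strengthen-⊢c (get ℓ M)   ρ-refl refl (getc d)      =
    getc (strengthen-⊢c M (ext-RenReflects ρ-refl) refl d)
  strengthen-⊢c (set ℓ W M) ρ-refl refl (setc d e ℓ∉) =
    setc (strengthen-⊢v W ρ-refl refl d) (strengthen-⊢c M ρ-refl refl e) ℓ∉

unweaken-⊢v : ∀ {Γ W δ δ₁} → (δ₁ ∷ Γ) ⊢v renV suc W ∶ δ → Γ ⊢v W ∶ δ
unweaken-⊢v {W = W} = strengthen-⊢v W (λ { (there x) → x }) refl

SubTyping : Ctx → Sub → Ctx → Set
SubTyping Γ′ s Γ = ∀ {n δ} → Γ ∋ n ∶ δ → Γ′ ⊢v s n ∶ δ

exts-SubTyping : ∀ {Γ Γ′ s δ} → SubTyping Γ′ s Γ → SubTyping (δ ∷ Γ′) (exts s) (δ ∷ Γ)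
exts-SubTyping s-ok here      = varv here
exts-SubTyping s-ok (there x) = weaken-⊢v (s-ok x)

single-SubTyping : ∀ {Γ V δ} → Γ ⊢v V ∶ δ → SubTyping Γ (single V) (δ ∷ Γ)
single-SubTyping v here      = v
single-SubTyping v (there x) = varv x

mutual
  subst-⊢v : ∀ {Γ Γ′ s W δ} → SubTyping Γ′ s Γ → Γ ⊢v W ∶ δ → Γ′ ⊢v subV s W ∶ δ
  subst-⊢v s-ok ωv          = ωv
  subst-⊢v s-ok (∧v d e)    = ∧v (subst-⊢v s-ok d) (subst-⊢v s-ok e)
  subst-⊢v s-ok (subv d le) = subv (subst-⊢v s-ok d) le
  subst-⊢v s-ok (varv x)    = s-ok x
  subst-⊢v s-ok (lamv d)    = lamv (subst-⊢c (exts-SubTyping s-ok) d)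

  subst-⊢c : ∀ {Γ Γ′ s M τ} → SubTyping Γ′ s Γ → Γ ⊢c M ∶ τ → Γ′ ⊢c subC s M ∶ τ
  subst-⊢c s-ok ωc            = ωc
  subst-⊢c s-ok (∧c d e)      = ∧c (subst-⊢c s-ok d) (subst-⊢c s-ok e)
  subst-⊢c s-ok (subc d le)   = subc (subst-⊢c s-ok d) le
  subst-⊢c s-ok (retc d)      = retc (subst-⊢v s-ok d)
  subst-⊢c s-ok (bindc d e)   = bindc (subst-⊢c s-ok d) (subst-⊢v s-ok e)
  subst-⊢c s-ok (getc d)      = getc (subst-⊢c (exts-SubTyping s-ok) d)
  subst-⊢c s-ok (setc d e ℓ∉) = setc (subst-⊢v s-ok d) (subst-⊢c s-ok e) ℓ∉

exts^ : ℕ → Sub → Sub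
exts^ zero    s = s
exts^ (suc k) s = exts (exts^ k s)

transport-var : ∀ {Γ Γ′ n n′ δ} → (∀ {δ₀} → Γ ∋ n ∶ δ₀ → Γ′ ∋ n′ ∶ δ₀) →
                Γ ⊢v var n ∶ δ → Γ′ ⊢v var n′ ∶ δ
transport-var x↦x′ ωv          = ωv
transport-var x↦x′ (∧v d e)    = ∧v (transport-var x↦x′ d) (transport-var x↦x′ e)
transport-var x↦x′ (subv d le) = subv (transport-var x↦x′ d) le
transport-var x↦x′ (varv x)    = varv (x↦x′ x)

module Inversion (Γ : Ctx) (V : Val) where

  -- M [ V ] with x lying just below the binders Δ.
  substUnder : Ctx → Sub
  substUnder Δ = exts^ (length Δ) (single V)

  TypeOfV : (VType → Set) → Set
  TypeOfV P = ∃ λ δ → Γ ⊢v V ∶ δ × P δ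

  meet : ∀ {P Q R : VType → Set} → TypeOfV P → TypeOfV Q →
         (∀ {δ δ′} → P δ → Q δ′ → R (δ ∧D δ′)) → TypeOfV R
  meet (δ , v , p) (δ′ , v′ , q) f = δ ∧D δ′ , ∧v v v′ , f p q

  invert-var : ∀ Δ n {δ′} → (Δ ++ Γ) ⊢v substUnder Δ n ∶ δ′ →
               TypeOfV λ δ → (Δ ++ δ ∷ Γ) ⊢v var n ∶ δ′
  invert-var []       zero    d = _ , d , varv here
  invert-var []       (suc n) d = ωD , ωv , weaken-⊢v d
  invert-var (_ ∷ Δ)  zero    d = ωD , ωv , transport-var (λ { here → here }) d
  invert-var (_ ∷ Δ)  (suc n) d = map₂ (map₂ weaken-⊢v) (invert-var Δ n (unweaken-⊢v d))

  mutual
    invert-⊢v : ∀ Δ W {W′ δ′} → subV (substUnder Δ) W ≡ W′ → (Δ ++ Γ) ⊢v W′ ∶ δ′ →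
                TypeOfV λ δ → (Δ ++ δ ∷ Γ) ⊢v W ∶ δ′
    invert-⊢v Δ (var n) refl d           = invert-var Δ n d
    invert-⊢v Δ (lam M) eq   ωv          = ωD , ωv , ωv
    invert-⊢v Δ (lam M) eq   (∧v d e)    =
      meet (invert-⊢v Δ (lam M) eq d) (invert-⊢v Δ (lam M) eq e)
           λ d′ e′ → ∧v (narrow-⊢v Δ lbˡD d′) (narrow-⊢v Δ lbʳD e′)
    invert-⊢v Δ (lam M) eq   (subv d le) = map₂ (map₂ λ d′ → subv d′ le) (invert-⊢v Δ (lam M) eq d)
    invert-⊢v Δ (lam M) refl (lamv {δ = δ₁} d) = map₂ (map₂ lamv) (invert-⊢c (δ₁ ∷ Δ) M refl d)

    invert-⊢c : ∀ Δ M {M′ τ} → subC (substUnder Δ) M ≡ M′ → (Δ ++ Γ) ⊢c M′ ∶ τ →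
                TypeOfV λ δ → (Δ ++ δ ∷ Γ) ⊢c M ∶ τ
    invert-⊢c Δ M eq ωc          = ωD , ωv , ωc
    invert-⊢c Δ M eq (∧c d e)    =
      meet (invert-⊢c Δ M eq d) (invert-⊢c Δ M eq e)
           λ d′ e′ → ∧c (narrow-⊢c Δ lbˡD d′) (narrow-⊢c Δ lbʳD e′)
    invert-⊢c Δ M eq (subc d le) = map₂ (map₂ λ d′ → subc d′ le) (invert-⊢c Δ M eq d)
    invert-⊢c Δ (ret W) refl (retc d) = map₂ (map₂ retc) (invert-⊢v Δ W refl d)
    invert-⊢c Δ (M ⋆ W) refl (bindc d e) =
      meet (invert-⊢c Δ M refl d) (invert-⊢v Δ W refl e)
           λ d′ e′ → bindc (narrow-⊢c Δ lbˡD d′) (narrow-⊢v Δ lbʳD e′)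
    invert-⊢c Δ (get ℓ M) refl (getc {δ = δ₁} d) = map₂ (map₂ getc) (invert-⊢c (δ₁ ∷ Δ) M refl d)
    invert-⊢c Δ (set ℓ W M) refl (setc d e ℓ∉) =
      meet (invert-⊢v Δ W refl d) (invert-⊢c Δ M refl e)
           λ d′ e′ → setc (narrow-⊢v Δ lbˡD d′) (narrow-⊢c Δ lbʳD e′) ℓ∉

mainTheorem14 : (Γ : Ctx) (M : Comp) (V : Val) (τ : TType) →
    ((δ : VType) → (δ ∷ Γ) ⊢c M ∶ τ → Γ ⊢v V ∶ δ → Γ ⊢c M [ V ] ∶ τ)
    × (Γ ⊢c M [ V ] ∶ τ → ∃ λ δ → Γ ⊢v V ∶ δ × (δ ∷ Γ) ⊢c M ∶ τ)
mainTheorem14 Γ M V τ =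
  (λ δ d v → subst-⊢c (single-SubTyping v) d) , Inversion.invert-⊢c Γ V [] M refl
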